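{- Let $G=(V,E)$ be a finite connected graph with $n=|V|$ vertices and distance matrix $D$. Suppose $G$ has a nonnegative curvature $w$, i.e. $w\in\mathbb{R}^n_{\geq 0}$ and $Dw=n\cdot\mathbf{1}$. Then for every vertex $u\in V$ we have $w(u)\leq \frac{1}{2}\|w\|_1$.
   Context: For a finite connected graph with vertices $v_1,\dots,v_n$, $d(u,v)$ is the shortest-path distance, the distance matrix is $D_{ij}=d(v_i,v_j)$, and $\mathbf{1}$ is the all-ones vector. A curvature of $G$ (in the sense of Steinerberger) is a function $w:V\to\mathbb{R}$, identified with the vector $(w(v_1),\dots,w(v_n))$, such that $\sum_{v\in V} d(u,v)w(v)=n$ for every $u\in V$, i.e. $Dw=n\cdot\mathbf{1}$. -}

module Defs where

open import Level using (Level; _⊔_) renaming (suc to lsuc)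
open import Data.Nat using (ℕ; zero; suc; _≤_)
open import Data.Fin using (Fin; zero; suc)
open import Data.Product using (∃; _×_)
open import Relation.Nullary using (¬_)
open import Relation.Binary using (Rel; IsTotalOrder)
open import Algebra.Bundles using (CommutativeRing)

record Graph (n : ℕ) : Set₁ where
  field
    Adj   : Fin n → Fin n → Set
    sym   : ∀ {u v} → Adj u v → Adj v u
    irrefl : ∀ {u} → ¬ Adj u u

data Walk {n : ℕ} (G : Graph n) : Fin n → Fin n → ℕ → Set where
  []  : ∀ {u} → Walk G u u zero
  _∷_ : ∀ {u v w k} → Graph.Adj G u v → Walk G v w k → Walk G u w (suc k)

Connected : ∀ {n} → Graph n → Set
Connected {n} G = ∀ (u v : Fin n) → ∃ λ k → Walk G u v k

IsDistance : ∀ {n} → Graph n → Fin n → Fin n → ℕ → Set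
IsDistance G u v k = Walk G u v k × (∀ {m} → Walk G u v m → k ≤ m)

IsDistanceMatrix : ∀ {n} → Graph n → (Fin n → Fin n → ℕ) → Set
IsDistanceMatrix {n} G D = ∀ (u v : Fin n) → IsDistance G u v (D u v)

-- Ordered fields (the statement is proved for every ordered field, ℝ included)

record OrderedField (c ℓ₁ ℓ₂ : Level) : Set (lsuc (c ⊔ ℓ₁ ⊔ ℓ₂)) where
  field
    commutativeRing : CommutativeRing c ℓ₁
  open CommutativeRing commutativeRing public
  infix 4 _≤F_
  field
    _≤F_         : Rel Carrier ℓ₂
    isTotalOrder : IsTotalOrder _≈_ _≤F_
    +-monoʳ-≤F   : ∀ {x y} z → x ≤F y → x + z ≤F y + z
    *-nonneg     : ∀ {x y} → 0# ≤F x → 0# ≤F y → 0# ≤F x * y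
    0≉1          : ¬ (0# ≈ 1#)
    inverse      : ∀ x → ¬ (x ≈ 0#) → ∃ λ y → x * y ≈ 1#

module _ {c ℓ₁ ℓ₂} (F : OrderedField c ℓ₁ ℓ₂) where
  open OrderedField F using (Carrier; _≈_; _≤F_; _+_; _*_; 0#; 1#)

  ι : ℕ → Carrier
  ι zero    = 0#
  ι (suc k) = 1# + ι k

  Σ : ∀ {n} → (Fin n → Carrier) → Carrier
  Σ {zero}  f = 0#
  Σ {suc n} f = f zero + Σ (λ i → f (suc i))

  IsCurvature : ∀ {n} → (Fin n → Fin n → ℕ) → (Fin n → Carrier) → Set ℓ₁
  IsCurvature {n} D w = ∀ (u : Fin n) → Σ (λ v → ι (D u v) * w v) ≈ ι n

  Nonneg : ∀ {n} → (Fin n → Carrier) → Set ℓ₂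
  Nonneg w = ∀ i → 0# ≤F w i

-- Let v be a neighbour of u. Moving from u to v changes every distance by at most one,
-- so d(u,x) ≤ d(v,x) + 1 for all x, with slack at x = u where d(u,u) = 0 but d(v,u) ≥ 1.
-- Weighting by w ≥ 0 and summing, Dw = n·1 gives n + 2 w(u) ≤ n + ‖w‖₁.
-- A one-vertex graph has no curvature (Dw = 0), and otherwise every vertex has a neighbour.
module Submission where

open import Defs
open import Level using (Level)
open import Data.Nat using (ℕ; zero; suc; z≤n; s≤s; _<_) renaming (_≤_ to _≤ℕ_)
open import Data.Fin using (Fin; zero; suc)
open import Data.Fin.Properties using (punchInᵢ≢i)
open import Data.Product using (∃; _,_; proj₁; proj₂)
open import Data.Sum using (inj₁; inj₂)
open import Data.Empty using (⊥-elim)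
open import Function using (_∘_)
open import Relation.Nullary using (¬_)
open import Relation.Binary using (Poset; IsTotalOrder)
open import Relation.Binary.PropositionalEquality using (_≡_; _≢_; refl; sym; cong; cong₂)

module _ {n : ℕ} (G : Graph n) where
  open Graph G using (Adj; irrefl)

  Walk-nonempty : ∀ {u v k} → u ≢ v → Walk G u v k → 0 < k
  Walk-nonempty u≢u []      = ⊥-elim (u≢u refl)
  Walk-nonempty _   (_ ∷ _) = s≤s z≤n

  Connected⇒∃-neighbour : Connected G → ∀ {u v} → u ≢ v → ∃ (Adj u)
  Connected⇒∃-neighbour conn {u} {v} u≢v with conn u v
  ... | _ , []    = ⊥-elim (u≢v refl)
  ... | _ , a ∷ _ = _ , a

  module _ {D : Fin n → Fin n → ℕ} (dist : IsDistanceMatrix G D) where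

    distance-self : ∀ u → D u u ≡ 0
    distance-self u with D u u | proj₂ (dist u u) []
    ... | .0 | z≤n = refl

    distance-adjacent : ∀ {u v} → Adj u v → ∀ x → D u x ≤ℕ suc (D v x)
    distance-adjacent {u} a x = proj₂ (dist u x) (a ∷ proj₁ (dist _ x))

    distance-adjacent-pos : ∀ {u v} → Adj u v → 0 < D v u
    distance-adjacent-pos {u} {v} a =
      Walk-nonempty (λ { refl → irrefl a }) (proj₁ (dist v u))

module _ {c ℓ₁ ℓ₂ : Level} (F : OrderedField c ℓ₁ ℓ₂) where
  open OrderedField F hiding (zero; refl; sym)
  open import Algebra.Properties.Ring ring
    using (-1*x≈-x; -‿involutive; -‿distribʳ-*; x[y-z]≈xy-xz; //-rightDividesˡ; \\-leftDividesʳ)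
  open import Algebra.Properties.CommutativeMonoid.Sum +-commutativeMonoid
    using (sum; ∑-distrib-+)
  module ≤ = IsTotalOrder isTotalOrder

  poset : Poset c ℓ₁ ℓ₂
  poset = record { isPartialOrder = ≤.isPartialOrder }

  open import Relation.Binary.Reasoning.PartialOrder poset

  +-monoˡ-≤F : ∀ {x y} z → x ≤F y → z + x ≤F z + y
  +-monoˡ-≤F {x} {y} z x≤y = begin
    z + x ≈⟨ +-comm z x ⟩
    x + z ≤⟨ +-monoʳ-≤F z x≤y ⟩
    y + z ≈⟨ +-comm y z ⟩
    z + y ∎

  +-mono-≤F : ∀ {x y u v} → x ≤F y → u ≤F v → x + u ≤F y + v
  +-mono-≤F {y = y} {u} x≤y u≤v = ≤.trans (+-monoʳ-≤F u x≤y) (+-monoˡ-≤F y u≤v)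

  +-cancelˡ-≤F : ∀ {x y} z → z + x ≤F z + y → x ≤F y
  +-cancelˡ-≤F {x} {y} z z+x≤z+y = begin
    x             ≈⟨ \\-leftDividesʳ z x ⟨
    - z + (z + x) ≤⟨ +-monoˡ-≤F (- z) z+x≤z+y ⟩
    - z + (z + y) ≈⟨ \\-leftDividesʳ z y ⟩
    y             ∎

  x≤y⇒0≤y-x : ∀ {x y} → x ≤F y → 0# ≤F y - x
  x≤y⇒0≤y-x {x} {y} x≤y = begin
    0#     ≈⟨ -‿inverseʳ x ⟨
    x - x  ≤⟨ +-monoʳ-≤F (- x) x≤y ⟩
    y - x  ∎

  x≤0⇒0≤-x : ∀ {x} → x ≤F 0# → 0# ≤F - x
  x≤0⇒0≤-x {x} x≤0 = ≤.trans (x≤y⇒0≤y-x x≤0) (≤.reflexive (+-identityˡ (- x)))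

  0≤-x⇒x≤0 : ∀ {x} → 0# ≤F - x → x ≤F 0#
  0≤-x⇒x≤0 {x} 0≤-x = begin
    x       ≈⟨ +-identityˡ x ⟨
    0# + x  ≤⟨ +-monoʳ-≤F x 0≤-x ⟩
    - x + x ≈⟨ -‿inverseˡ x ⟩
    0#      ∎

  *-monoˡ-≤F-nonneg : ∀ {z x y} → 0# ≤F z → x ≤F y → z * x ≤F z * y
  *-monoˡ-≤F-nonneg {z} {x} {y} 0≤z x≤y = begin
    z * x                   ≈⟨ +-identityˡ (z * x) ⟨
    0# + z * x              ≤⟨ +-monoʳ-≤F (z * x) (*-nonneg 0≤z (x≤y⇒0≤y-x x≤y)) ⟩
    z * (y - x) + z * x     ≈⟨ +-congʳ (x[y-z]≈xy-xz z y x) ⟩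
    (z * y - z * x) + z * x ≈⟨ //-rightDividesˡ (z * x) (z * y) ⟩
    z * y                   ∎

  0≤1 : 0# ≤F 1#
  0≤1 with ≤.total 0# 1#
  ... | inj₁ 0≤1 = 0≤1
  ... | inj₂ 1≤0 = begin
    0#          ≤⟨ *-nonneg 0≤-1 0≤-1 ⟩
    - 1# * - 1# ≈⟨ -1*x≈-x (- 1#) ⟩
    - (- 1#)    ≈⟨ -‿involutive 1# ⟩
    1#          ∎
    where 0≤-1 = x≤0⇒0≤-x 1≤0

  x*y≈1⇒0≤x⇒0≤y : ∀ {x y} → x * y ≈ 1# → 0# ≤F x → 0# ≤F y
  x*y≈1⇒0≤x⇒0≤y {x} {y} xy≈1 0≤x with ≤.total 0# y
  ... | inj₁ 0≤y = 0≤y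
  ... | inj₂ y≤0 = ⊥-elim (0≉1 (≤.antisym 0≤1 (0≤-x⇒x≤0 0≤-1)))
    where
    0≤-1 : 0# ≤F - 1#
    0≤-1 = begin
      0#       ≤⟨ *-nonneg 0≤x (x≤0⇒0≤-x y≤0) ⟩
      x * - y  ≈⟨ -‿distribʳ-* x y ⟨
      - (x * y) ≈⟨ -‿cong xy≈1 ⟩
      - 1#     ∎

  ι-nonneg : ∀ k → 0# ≤F ι F k
  ι-nonneg zero    = ≤.refl
  ι-nonneg (suc k) = begin
    0#           ≈⟨ +-identityʳ 0# ⟨
    0# + 0#      ≤⟨ +-mono-≤F 0≤1 (ι-nonneg k) ⟩
    1# + ι F k   ∎

  ι-suc-* : ∀ k x → ι F (suc k) * x ≈ ι F k * x + x
  ι-suc-* k x = trans (distribʳ x 1# (ι F k)) (trans (+-congʳ (*-identityˡ x)) (+-comm x _))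

  ι-one-* : ∀ x → ι F 1 * x ≈ x
  ι-one-* x = trans (ι-suc-* 0 x) (trans (+-congʳ (zeroˡ x)) (+-identityˡ x))

  ι-mono-* : ∀ {m k x} → m ≤ℕ k → 0# ≤F x → ι F m * x ≤F ι F k * x
  ι-mono-* {k = k} {x} z≤n 0≤x = begin
    0# * x    ≈⟨ zeroˡ x ⟩
    0#        ≤⟨ *-nonneg (ι-nonneg k) 0≤x ⟩
    ι F k * x ∎
  ι-mono-* {suc m} {suc k} {x} (s≤s m≤k) 0≤x = begin
    ι F (suc m) * x ≈⟨ ι-suc-* m x ⟩
    ι F m * x + x   ≤⟨ +-monoʳ-≤F x (ι-mono-* m≤k 0≤x) ⟩
    ι F k * x + x   ≈⟨ ι-suc-* k x ⟨
    ι F (suc k) * x ∎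

  Σ≡sum : ∀ {m} (f : Fin m → Carrier) → Σ F f ≡ sum f
  Σ≡sum {zero}  f = refl
  Σ≡sum {suc m} f = cong (f zero +_) (Σ≡sum (f ∘ suc))

  Σ-distrib-+ : ∀ {m} (f g : Fin m → Carrier) → Σ F (λ i → f i + g i) ≈ Σ F f + Σ F g
  Σ-distrib-+ f g = begin-equality
    Σ F (λ i → f i + g i) ≡⟨ Σ≡sum (λ i → f i + g i) ⟩
    sum (λ i → f i + g i) ≈⟨ ∑-distrib-+ f g ⟩
    sum f + sum g         ≡⟨ cong₂ _+_ (Σ≡sum f) (Σ≡sum g) ⟨
    Σ F f + Σ F g         ∎

  Σ-mono-≤F : ∀ {m} {f g : Fin m → Carrier} → (∀ i → f i ≤F g i) → Σ F f ≤F Σ F g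
  Σ-mono-≤F {zero}  f≤g = ≤.refl
  Σ-mono-≤F {suc m} f≤g = +-mono-≤F (f≤g zero) (Σ-mono-≤F (f≤g ∘ suc))

  Σ-mono-≤F-with-gap : ∀ {m} {f g : Fin m → Carrier} {a} u →
                       (∀ i → f i ≤F g i) → f u + a ≤F g u → Σ F f + a ≤F Σ F g
  Σ-mono-≤F-with-gap {f = f} {g} {a} zero f≤g gap = begin
    (f zero + Σ F (f ∘ suc)) + a ≈⟨ +-assoc _ _ a ⟩
    f zero + (Σ F (f ∘ suc) + a) ≈⟨ +-congˡ (+-comm _ a) ⟩
    f zero + (a + Σ F (f ∘ suc)) ≈⟨ +-assoc _ a _ ⟨
    (f zero + a) + Σ F (f ∘ suc) ≤⟨ +-mono-≤F gap (Σ-mono-≤F (f≤g ∘ suc)) ⟩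
    g zero + Σ F (g ∘ suc)       ∎
  Σ-mono-≤F-with-gap {f = f} {g} {a} (suc u) f≤g gap = begin
    (f zero + Σ F (f ∘ suc)) + a ≈⟨ +-assoc _ _ a ⟩
    f zero + (Σ F (f ∘ suc) + a) ≤⟨ +-mono-≤F (f≤g zero) (Σ-mono-≤F-with-gap u (f≤g ∘ suc) gap) ⟩
    g zero + Σ F (g ∘ suc)       ∎

  2*x≈1⇒x*[y+y]≈y : ∀ {x} → (1# + 1#) * x ≈ 1# → ∀ y → x * (y + y) ≈ y
  2*x≈1⇒x*[y+y]≈y {x} 2x≈1 y = begin-equality
    x * (y + y)          ≈⟨ *-congˡ (+-cong (*-identityˡ y) (*-identityˡ y)) ⟨
    x * (1# * y + 1# * y) ≈⟨ *-congˡ (distribʳ y 1# 1#) ⟨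
    x * ((1# + 1#) * y)  ≈⟨ *-assoc x _ y ⟨
    (x * (1# + 1#)) * y  ≈⟨ *-congʳ (trans (*-comm x _) 2x≈1) ⟩
    1# * y               ≈⟨ *-identityˡ y ⟩
    y                    ∎

  2*x≈1⇒0≤x : ∀ {x} → (1# + 1#) * x ≈ 1# → 0# ≤F x
  2*x≈1⇒0≤x 2x≈1 = x*y≈1⇒0≤x⇒0≤y 2x≈1 (begin
    0#      ≈⟨ +-identityʳ 0# ⟨
    0# + 0# ≤⟨ +-mono-≤F 0≤1 0≤1 ⟩
    1# + 1# ∎)

  one-vertex-has-no-curvature : (G : Graph 1) {D : Fin 1 → Fin 1 → ℕ} → IsDistanceMatrix G D →
                                {w : Fin 1 → Carrier} → ¬ IsCurvature F D w
  one-vertex-has-no-curvature G {D} dist {w} curv = 0≉1 (begin-equality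
    0#                             ≈⟨ zeroˡ (w zero) ⟨
    ι F 0 * w zero                 ≡⟨ cong (λ k → ι F k * w zero) (distance-self G dist zero) ⟨
    ι F (D zero zero) * w zero     ≈⟨ +-identityʳ _ ⟨
    ι F (D zero zero) * w zero + 0# ≈⟨ curv zero ⟩
    1# + 0#                        ≈⟨ +-identityʳ 1# ⟩
    1#                             ∎)

  module _ {n} (G : Graph n) {D : Fin n → Fin n → ℕ} (dist : IsDistanceMatrix G D)
           {w : Fin n → Carrier} (w≥0 : Nonneg F w) (curv : IsCurvature F D w) where
    open Graph G using (Adj)

    curvature-double≤Σ : ∀ {u v} → Adj u v → w u + w u ≤F Σ F w
    curvature-double≤Σ {u} {v} a = +-cancelˡ-≤F (ι F n) (begin
      ι F n + (w u + w u)                          ≈⟨ +-congʳ (curv u) ⟨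
      Σ F (λ x → ι F (D u x) * w x) + (w u + w u) ≤⟨ Σ-mono-≤F-with-gap u pointwise gap ⟩
      Σ F (λ x → ι F (D v x) * w x + w x)         ≈⟨ Σ-distrib-+ (λ x → ι F (D v x) * w x) w ⟩
      Σ F (λ x → ι F (D v x) * w x) + Σ F w       ≈⟨ +-congʳ (curv v) ⟩
      ι F n + Σ F w                               ∎)
      where
      pointwise : ∀ x → ι F (D u x) * w x ≤F ι F (D v x) * w x + w x
      pointwise x = begin
        ι F (D u x) * w x       ≤⟨ ι-mono-* (distance-adjacent G dist a x) (w≥0 x) ⟩
        ι F (suc (D v x)) * w x ≈⟨ ι-suc-* (D v x) (w x) ⟩
        ι F (D v x) * w x + w x ∎
      gap : ι F (D u u) * w u + (w u + w u) ≤F ι F (D v u) * w u + w u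
      gap = begin
        ι F (D u u) * w u + (w u + w u) ≡⟨ cong (λ k → ι F k * w u + (w u + w u)) (distance-self G dist u) ⟩
        0# * w u + (w u + w u)          ≈⟨ trans (+-congʳ (zeroˡ (w u))) (+-identityˡ _) ⟩
        w u + w u                       ≈⟨ +-congʳ (ι-one-* (w u)) ⟨
        ι F 1 * w u + w u               ≤⟨ +-monoʳ-≤F (w u) (ι-mono-* (distance-adjacent-pos G dist a) (w≥0 u)) ⟩
        ι F (D v u) * w u + w u         ∎

    curvature-bound : ∀ {u v} → Adj u v → ∀ half → (1# + 1#) * half ≈ 1# → w u ≤F half * Σ F w
    curvature-bound {u} a half 2h≈1 = begin
      w u                ≈⟨ 2*x≈1⇒x*[y+y]≈y 2h≈1 (w u) ⟨
      half * (w u + w u) ≤⟨ *-monoˡ-≤F-nonneg (2*x≈1⇒0≤x 2h≈1) (curvature-double≤Σ a) ⟩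
      half * Σ F w       ∎

proposition1 : ∀ {c ℓ₁ ℓ₂ : Level} (F : OrderedField c ℓ₁ ℓ₂) (n : ℕ)
                 (G : Graph n) → Connected G →
                 (D : Fin n → Fin n → ℕ) → IsDistanceMatrix G D →
                 (w : Fin n → OrderedField.Carrier F) → Nonneg F w → IsCurvature F D w →
                 (half : OrderedField.Carrier F) →
                 OrderedField._≈_ F (OrderedField._*_ F (OrderedField._+_ F (OrderedField.1# F) (OrderedField.1# F)) half) (OrderedField.1# F) →
                 ∀ (u : Fin n) → OrderedField._≤F_ F (w u) (OrderedField._*_ F half (Σ F w))
proposition1 F zero          G conn D dist w w≥0 curv half 2h≈1 ()
proposition1 F (suc zero)    G conn D dist w w≥0 curv half 2h≈1 u =
  ⊥-elim (one-vertex-has-no-curvature F G dist {w} curv)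
proposition1 F (suc (suc m)) G conn D dist w w≥0 curv half 2h≈1 u =
  curvature-bound F G dist w≥0 curv (proj₂ neighbour) half 2h≈1
  where neighbour = Connected⇒∃-neighbour G conn (punchInᵢ≢i u zero ∘ sym)
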